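{- Let $a \geq 0$, $b \geq 1$, $k \geq 1$ and $j \geq 0$ be integers, and consider the recursion $$A(n) = A\big(n-a-A^k(n-b)\big) + A\big(A^k(n-b)\big) \quad (n > b+j),$$ where $A^k$ denotes the $k$-fold composition of $A$, given $b+j$ initial values $A(1),\dots,A(b+j)$. Suppose that: (I) the $b+j$ initial values are positive integers, they are slow-growing (i.e. $A(i)-A(i-1)\in\{0,1\}$ for $2\le i\le b+j$), and $A(1)=1$; (II) $A(b+j+1)$ is defined by the recursion and satisfies $A(b+j+1)-A(b+j)\in\{0,1\}$. Then $A(n)$ is defined for all positive integers $n$, the sequence satisfies $A(n)-A(n-1)\in\{0,1\}$ for all $n\ge 2$, and it is unbounded.
   Context: A term $A(n)$ with $n>b+j$ is said to be defined by the recursion if all earlier terms needed are defined and the arguments $A^k(n-b)$ and $n-a-A^k(n-b)$ used in the recursion both lie in the interval $[1,n-1]$ (so that the right-hand side refers only to already defined terms). A sequence of positive integers is slow-growing if consecutive differences lie in $\{0,1\}$. -}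

module Defs where

open import Data.Nat using (ℕ; zero; suc; _+_; _∸_; _≤_; _<_)
open import Data.Product using (_×_; ∃-syntax)
open import Data.Sum using (_⊎_)
open import Relation.Binary.PropositionalEquality using (_≡_)

iter : (ℕ → ℕ) → ℕ → ℕ → ℕ
iter A zero    x = x
iter A (suc k) x = A (iter A k x)

Step : ℕ → ℕ → Set
Step x y = (y ≡ x) ⊎ (y ≡ suc x)

-- The term A(n) is "defined by the recursion" (given that A(1..n-1) are
-- defined): every argument needed lies in [1, n-1].  The arguments needed
-- are A^i(n-b) for 0 ≤ i ≤ k (the intermediate ones to evaluate A^k(n-b),
-- and A^k(n-b) itself), and n - a - A^k(n-b) (i.e. 1 ≤ n-a-A^k(n-b), the
-- upper bound n-1 following from A^k(n-b) ≥ 1).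
ArgsOK : (A : ℕ → ℕ) (a b k n : ℕ) → Set
ArgsOK A a b k n =
  (∀ i → i ≤ k → (1 ≤ iter A i (n ∸ b)) × (iter A i (n ∸ b) < n))
  × (a + iter A k (n ∸ b) < n)

RHS : (A : ℕ → ℕ) (a b k n : ℕ) → ℕ
RHS A a b k n = A (n ∸ a ∸ iter A k (n ∸ b)) + A (iter A k (n ∸ b))

module Submission where

-- Suppose A is slow-growing (steps in {0,1}) on [1,m] with A(1) = 1,
-- and the recursion is well defined and holds at m.  Then 1 ≤ A y ≤ y and A
-- is monotone there, and so is every iterate A^i.  Put x = m - b and
-- T = A^k(x).  Since A^k is slow, T' = A^k(x+1) is T or T+1:
--   * if T' = T, then A(m+1) - A(m) = A(d+1) - A(d) with d = m - a - T;
--   * if T' = T+1, then A(m+1) - A(m) = A(T+1) - A(T).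
-- Either way the new step is an old step, and all arguments used at m+1 stay
-- inside [1,m]; induction on m gives definedness and slow growth.  For
-- unboundedness: if A(m) ≤ M then T ≤ A(m) ≤ M, so d ≥ m - a - M, and
-- A(m) = A(d) + A(T) > A(d); choosing m large forces A(m) above any value M.

open import Defs
open import Data.Nat using (ℕ; zero; suc; _+_; _∸_; _≤_; _<_; z≤n; s≤s; _≟_; _<?_)
open import Data.Nat.Properties
open import Data.Product using (_×_; _,_; proj₁; proj₂; ∃-syntax)
open import Data.Sum using (inj₁; inj₂)
open import Data.Empty using (⊥-elim)
open import Relation.Nullary using (Dec; yes; no; ¬_)
open import Relation.Binary using (tri<; tri≈; tri>)
open import Relation.Binary.PropositionalEquality
  using (_≡_; _≢_; refl; sym; trans; cong; cong₂; subst; subst₂; ≢-sym; module ≡-Reasoning)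

positive-difference : ∀ {m n} → 1 ≤ m ∸ n → n ≤ m
positive-difference pos = <⇒≤ (m∸n≢0⇒n<m (≢-sym (<⇒≢ pos)))

inner-index : ∀ n a t → 1 ≤ t → a + t < n → (1 ≤ n ∸ a ∸ t) × (n ∸ a ∸ t < n)
inner-index n a t t≥1 lt rewrite ∸-+-assoc n a t =
  m<n⇒0<n∸m lt , ∸-monoʳ-< (≤-trans t≥1 (m≤n+m t a)) (<⇒≤ lt)

inner-index-≤ : ∀ m a t → 1 ≤ t → suc m ∸ a ∸ t ≤ m
inner-index-≤ m a t t≥1 = ≤-trans (∸-monoˡ-≤ t (m∸n≤m (suc m) a)) (∸-monoʳ-≤ (suc m) t≥1)

inner-index-suc : ∀ m a t → a + t ≤ m → suc m ∸ a ∸ t ≡ suc (m ∸ a ∸ t)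
inner-index-suc m a t le = begin
  suc m ∸ a ∸ t     ≡⟨ ∸-+-assoc (suc m) a t ⟩
  suc m ∸ (a + t)   ≡⟨ +-∸-assoc 1 le ⟩
  suc (m ∸ (a + t)) ≡⟨ cong suc (sym (∸-+-assoc m a t)) ⟩
  suc (m ∸ a ∸ t)   ∎
  where open ≡-Reasoning

inner-index-suc-suc : ∀ m a t → suc m ∸ a ∸ suc t ≡ m ∸ a ∸ t
inner-index-suc-suc m a t = begin
  suc m ∸ a ∸ suc t     ≡⟨ ∸-+-assoc (suc m) a (suc t) ⟩
  suc m ∸ (a + suc t)   ≡⟨ cong (suc m ∸_) (+-suc a t) ⟩
  m ∸ (a + t)           ≡⟨ sym (∸-+-assoc m a t) ⟩
  m ∸ a ∸ t             ∎
  where open ≡-Reasoning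

step-≤ : ∀ {x y} → Step x y → x ≤ y
step-≤ (inj₁ refl) = ≤-refl
step-≤ (inj₂ refl) = n≤1+n _

step-≤-suc : ∀ {x y} → Step x y → y ≤ suc x
step-≤-suc (inj₁ refl) = n≤1+n _
step-≤-suc (inj₂ refl) = ≤-refl

step-+ʳ : ∀ {x y} c → Step x y → Step (x + c) (y + c)
step-+ʳ c (inj₁ refl) = inj₁ refl
step-+ʳ c (inj₂ refl) = inj₂ refl

step-+ˡ : ∀ {x y} c → Step x y → Step (c + x) (c + y)
step-+ˡ c (inj₁ refl) = inj₁ refl
step-+ˡ c (inj₂ refl) = inj₂ (+-suc c _)

-- Locality: the recursion at n = m + 1 only reads values on [0, m]

AgreeUpTo : (ℕ → ℕ) → (ℕ → ℕ) → ℕ → Set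
AgreeUpTo f g m = ∀ z → z ≤ m → f z ≡ g z

iter-local : ∀ {f g m} → AgreeUpTo f g m → ∀ i y
  → (∀ l → l < i → iter g l y ≤ m) → iter f i y ≡ iter g i y
iter-local agree zero    y inside = refl
iter-local {f} {g} agree (suc i) y inside = begin
  f (iter f i y) ≡⟨ cong f (iter-local agree i y (λ l l<i → inside l (m<n⇒m<1+n l<i))) ⟩
  f (iter g i y) ≡⟨ agree _ (inside i ≤-refl) ⟩
  g (iter g i y) ∎
  where open ≡-Reasoning

recursion-local : ∀ a b k {f g m} → AgreeUpTo f g m → ArgsOK g a b k (suc m)
  → ArgsOK f a b k (suc m) × (RHS f a b k (suc m) ≡ RHS g a b k (suc m))
recursion-local a b k {f} {g} {m} agree (orbit-ok , outer-ok) =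
  (orbit-f , outer-f) , rhs-eq
  where
  x T : ℕ
  x = suc m ∸ b
  T = iter g k x
  same : ∀ i → i ≤ k → iter f i x ≡ iter g i x
  same i i≤k = iter-local agree i x
    (λ l l<i → ≤-pred (proj₂ (orbit-ok l (<⇒≤ (<-≤-trans l<i i≤k)))))
  orbit-f : ∀ i → i ≤ k → (1 ≤ iter f i x) × (iter f i x < suc m)
  orbit-f i i≤k rewrite same i i≤k = orbit-ok i i≤k
  outer-f : a + iter f k x < suc m
  outer-f rewrite same k ≤-refl = outer-ok
  T≥1 : 1 ≤ T
  T≥1 = proj₁ (orbit-ok k ≤-refl)
  rhs-eq : RHS f a b k (suc m) ≡ RHS g a b k (suc m)
  rhs-eq rewrite same k ≤-refl =
    cong₂ _+_ (agree _ (inner-index-≤ m a T T≥1)) (agree T (≤-pred (proj₂ (orbit-ok k ≤-refl))))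

SlowUpTo : (ℕ → ℕ) → ℕ → Set
SlowUpTo A m = ∀ y → 1 ≤ y → suc y ≤ m → Step (A y) (A (suc y))

slow-extend : ∀ {A m} → SlowUpTo A m → (1 ≤ m → Step (A m) (A (suc m))) → SlowUpTo A (suc m)
slow-extend {m = m} slow new y y≥1 y<sm with m≤n⇒m<n∨m≡n (≤-pred y<sm)
... | inj₁ y<m  = slow y y≥1 y<m
... | inj₂ refl = new y≥1

module SlowGrowing {A : ℕ → ℕ} (A1 : A 1 ≡ 1) {m : ℕ} (slow : SlowUpTo A m) where

  bounds : ∀ y → 1 ≤ y → y ≤ m → (1 ≤ A y) × (A y ≤ y)
  bounds (suc zero) _ _ rewrite A1 = ≤-refl , ≤-refl
  bounds (suc (suc z)) _ y≤m with bounds (suc z) (s≤s z≤n) (≤-trans (n≤1+n _) y≤m)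
                                | slow (suc z) (s≤s z≤n) y≤m
  ... | (lo , hi) | inj₁ eq rewrite eq = lo , m≤n⇒m≤1+n hi
  ... | (lo , hi) | inj₂ eq rewrite eq = s≤s z≤n , s≤s hi

  monotone : ∀ y z → 1 ≤ y → y ≤ z → z ≤ m → A y ≤ A z
  monotone y zero    y≥1 y≤z _   = ⊥-elim (<⇒≱ y≥1 y≤z)
  monotone y (suc z) y≥1 y≤z z≤m with m≤n⇒m<n∨m≡n y≤z
  ... | inj₂ refl = ≤-refl
  ... | inj₁ y<sz = ≤-trans (monotone y z y≥1 (≤-pred y<sz) (≤-trans (n≤1+n z) z≤m))
                            (step-≤ (slow z (≤-trans y≥1 (≤-pred y<sz)) z≤m))

  iter-bounds : ∀ i y → 1 ≤ y → y ≤ m → (1 ≤ iter A i y) × (iter A i y ≤ y)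
  iter-bounds zero    y y≥1 _   = y≥1 , ≤-refl
  iter-bounds (suc i) y y≥1 y≤m =
    let (lo , hi) = iter-bounds i y y≥1 y≤m
        (lo' , hi') = bounds (iter A i y) lo (≤-trans hi y≤m)
    in lo' , ≤-trans hi' hi

  iter-≤ : ∀ i → 1 ≤ i → ∀ y → 1 ≤ y → y ≤ m → iter A i y ≤ A y
  iter-≤ (suc i) _ y y≥1 y≤m =
    let (lo , hi) = iter-bounds i y y≥1 y≤m in monotone _ y lo hi y≤m

  iter-step : ∀ i y → 1 ≤ y → suc y ≤ m → Step (iter A i y) (iter A i (suc y))
  iter-step zero    y _   _    = inj₂ refl
  iter-step (suc i) y y≥1 sy≤m with iter-step i y y≥1 sy≤m
  ... | inj₁ eq = inj₁ (cong A eq)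
  ... | inj₂ eq = subst (λ w → Step (A (iter A i y)) (A w)) (sym eq) (slow _ lo u<m)
    where
    lo : 1 ≤ iter A i y
    lo = proj₁ (iter-bounds i y y≥1 (≤-trans (n≤1+n y) sy≤m))
    u<m : suc (iter A i y) ≤ m
    u<m = subst (_≤ m) eq (≤-trans (proj₂ (iter-bounds i (suc y) (s≤s z≤n) sy≤m)) sy≤m)

module RecursionStep (a b k : ℕ) (b≥1 : 1 ≤ b) {A : ℕ → ℕ} (A1 : A 1 ≡ 1) {m : ℕ}
  (slow : SlowUpTo A m) (args : ArgsOK A a b k m) where

  open SlowGrowing A1 slow

  x T d : ℕ
  x = m ∸ b
  T = iter A k x
  d = m ∸ a ∸ T

  x≥1 : 1 ≤ x
  x≥1 = proj₁ (proj₁ args 0 z≤n)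

  sx≤m : suc x ≤ m
  sx≤m = ∸-monoʳ-< b≥1 (positive-difference x≥1)

  shift : suc m ∸ b ≡ suc x
  shift = +-∸-assoc 1 {m} {b} (positive-difference x≥1)

  T≥1 : 1 ≤ T
  T≥1 = proj₁ (proj₁ args k ≤-refl)

  a+T<m : a + T < m
  a+T<m = proj₂ args

  args-next : ArgsOK A a b k (suc m)
  args-next = orbit , outer
    where
    orbit : ∀ i → i ≤ k → (1 ≤ iter A i (suc m ∸ b)) × (iter A i (suc m ∸ b) < suc m)
    orbit i _ rewrite shift =
      let (lo , hi) = iter-bounds i (suc x) (s≤s z≤n) sx≤m in lo , s≤s (≤-trans hi sx≤m)
    outer : a + iter A k (suc m ∸ b) < suc m
    outer rewrite shift =
      s≤s (≤-trans (+-monoʳ-≤ a (step-≤-suc (iter-step k x x≥1 sx≤m)))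
                   (subst (_≤ m) (sym (+-suc a T)) a+T<m))

  step-next : A m ≡ RHS A a b k m → A (suc m) ≡ RHS A a b k (suc m) → Step (A m) (A (suc m))
  step-next rec-m rec-sm =
    subst₂ Step (sym rec-m) (sym (trans rec-sm rhs-shift)) (by-cases (iter-step k x x≥1 sx≤m))
    where
    rhs-shift : RHS A a b k (suc m) ≡ A (suc m ∸ a ∸ iter A k (suc x)) + A (iter A k (suc x))
    rhs-shift = cong (λ w → A (suc m ∸ a ∸ iter A k w) + A (iter A k w)) shift
    d-inside : (1 ≤ d) × (d < m)
    d-inside = inner-index m a T T≥1 a+T<m
    by-cases : ∀ {t} → Step T t → Step (A d + A T) (A (suc m ∸ a ∸ t) + A t)
    by-cases (inj₁ refl) rewrite inner-index-suc m a T (<⇒≤ a+T<m) =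
      step-+ʳ (A T) (slow d (proj₁ d-inside) (proj₂ d-inside))
    by-cases (inj₂ refl) rewrite inner-index-suc-suc m a T =
      step-+ˡ (A d) (slow T T≥1 (≤-trans (s≤s (m≤n+m T a)) a+T<m))

-- Growth and unboundedness

module Growth (a b k : ℕ) (k≥1 : 1 ≤ k) {A : ℕ → ℕ} (A1 : A 1 ≡ 1) where

  -- Where the recursion holds, A(m) exceeds A(n) for every n ≥ 1 with
  -- n + a + A(m) ≤ m: the outer argument d = m - a - A^k(m-b) is ≥ n.
  growth : ∀ {m n} → SlowUpTo A m → ArgsOK A a b k m → A m ≡ RHS A a b k m
    → 1 ≤ n → n + (a + A m) ≤ m → A n < A m
  growth {m} {n} slow (orbit-ok , _) rec n≥1 room =
    subst (A n <_) (sym rec) (≤-trans (s≤s (monotone n d n≥1 n≤d d≤m)) A-sum)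
    where
    open SlowGrowing A1 slow
    x T d : ℕ
    x = m ∸ b
    T = iter A k x
    d = m ∸ a ∸ T
    x≥1 : 1 ≤ x
    x≥1 = proj₁ (orbit-ok 0 z≤n)
    T≥1 : 1 ≤ T
    T≥1 = proj₁ (orbit-ok k ≤-refl)
    T≤Am : T ≤ A m
    T≤Am = ≤-trans (iter-≤ k k≥1 x x≥1 (m∸n≤m m b)) (monotone x m x≥1 (m∸n≤m m b) ≤-refl)
    n≤d : n ≤ d
    n≤d = subst (n ≤_) (sym (∸-+-assoc m a T))
            (≤-trans (m+n≤o⇒m≤o∸n n room) (∸-monoʳ-≤ m (+-monoʳ-≤ a T≤Am)))
    d≤m : d ≤ m
    d≤m = ≤-trans (m∸n≤m (m ∸ a) T) (m∸n≤m m a)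
    A-sum : suc (A d) ≤ A d + A T
    A-sum = subst (_≤ A d + A T) (+-comm (A d) 1)
              (+-monoʳ-≤ (A d) (proj₁ (bounds T T≥1 (<⇒≤ (proj₂ (orbit-ok k ≤-refl))))))

  unbounded : ∀ N → (∀ m → SlowUpTo A m)
    → (∀ m → N < m → ArgsOK A a b k m × (A m ≡ RHS A a b k m))
    → ∀ M → ∃[ n ] ((1 ≤ n) × (M ≤ A n))
  unbounded N slow recursion zero    = 1 , ≤-refl , z≤n
  unbounded N slow recursion (suc M) =
    let (n , n≥1 , M≤An) = unbounded N slow recursion M
    in exceed n n≥1 M≤An
    where
    -- From some value ≥ M, a far enough index m has A(m) > M: either
    -- directly, or A(m) ≤ M leaves room for growth above A(n).
    exceed : ∀ n → 1 ≤ n → M ≤ A n → ∃[ m ] ((1 ≤ m) × (suc M ≤ A m))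
    exceed n n≥1 M≤An = m , ≤-trans (s≤s z≤n) N<m , decide (M <? A m)
      where
      m = n + (a + M) + suc N
      N<m : N < m
      N<m = m≤n+m (suc N) (n + (a + M))
      decide : Dec (M < A m) → M < A m
      decide (yes M<Am) = M<Am
      decide (no M≮Am)  =
        ≤-<-trans M≤An (growth (slow m) (proj₁ (recursion m N<m)) (proj₂ (recursion m N<m)) n≥1
          (≤-trans (+-monoʳ-≤ n (+-monoʳ-≤ a (≮⇒≥ M≮Am))) (m≤m+n (n + (a + M)) (suc N))))

-- Construction of the sequence

update : (ℕ → ℕ) → ℕ → ℕ → ℕ → ℕ
update f p v x with x ≟ p
... | yes _ = v
... | no  _ = f x

update-here : ∀ f p v → update f p v p ≡ v
update-here f p v with p ≟ p
... | yes _   = refl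
... | no  p≢p = ⊥-elim (p≢p refl)

update-there : ∀ f p v x → x ≢ p → update f p v x ≡ f x
update-there f p v x x≢p with x ≟ p
... | yes x≡p = ⊥-elim (x≢p x≡p)
... | no  _   = refl

-- approx m agrees with the intended sequence on [0, m]: it takes the initial
-- values up to N and applies the recursion (to approx m) at m + 1 > N.
-- The sequence itself is the diagonal  seq n = approx n n.
module Construction (a b k N : ℕ) (init : ℕ → ℕ) where

  next : (ℕ → ℕ) → ℕ → ℕ
  next f n with N <? n
  ... | yes _ = RHS f a b k n
  ... | no  _ = init n

  next-init : ∀ f n → ¬ N < n → next f n ≡ init n
  next-init f n N≮n with N <? n
  ... | yes N<n = ⊥-elim (N≮n N<n)
  ... | no  _   = refl

  next-rec : ∀ f n → N < n → next f n ≡ RHS f a b k n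
  next-rec f n N<n with N <? n
  ... | yes _   = refl
  ... | no  N≮n = ⊥-elim (N≮n N<n)

  approx : ℕ → ℕ → ℕ
  approx zero    = init
  approx (suc m) = update (approx m) (suc m) (next (approx m) (suc m))

  seq : ℕ → ℕ
  seq n = approx n n

  approx-agrees : ∀ m → AgreeUpTo (approx m) seq m
  approx-agrees zero    .zero z≤n = refl
  approx-agrees (suc m) z     z≤sm with m≤n⇒m<n∨m≡n z≤sm
  ... | inj₂ refl = refl
  ... | inj₁ z<sm = trans (update-there (approx m) (suc m) _ z (<⇒≢ z<sm))
                          (approx-agrees m z (≤-pred z<sm))

  seq-suc : ∀ m → seq (suc m) ≡ next (approx m) (suc m)
  seq-suc m = update-here (approx m) (suc m) _

  seq-init : ∀ n → n ≤ N → seq n ≡ init n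
  seq-init zero    _   = refl
  seq-init (suc m) sm≤N = trans (seq-suc m) (next-init (approx m) (suc m) (≤⇒≯ sm≤N))

  seq-rec : ∀ m → N ≤ m → ArgsOK seq a b k (suc m) → seq (suc m) ≡ RHS seq a b k (suc m)
  seq-rec m N≤m args = begin
    seq (suc m)                   ≡⟨ seq-suc m ⟩
    next (approx m) (suc m)       ≡⟨ next-rec (approx m) (suc m) (s≤s N≤m) ⟩
    RHS (approx m) a b k (suc m)  ≡⟨ proj₂ (recursion-local a b k (approx-agrees m) args) ⟩
    RHS seq a b k (suc m)         ∎
    where open ≡-Reasoning

module Main (a b k j : ℕ) (b≥1 : 1 ≤ b) (init : ℕ → ℕ)
  (init-slow : ∀ i → 2 ≤ i → i ≤ b + j → Step (init (i ∸ 1)) (init i))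
  (init-one : init 1 ≡ 1)
  (init-args : ArgsOK init a b k (suc (b + j)))
  (init-step : Step (init (b + j)) (RHS init a b k (suc (b + j)))) where

  N : ℕ
  N = b + j
  open Construction a b k N init public

  seq-one : seq 1 ≡ 1
  seq-one = trans (seq-init 1 (≤-trans b≥1 (m≤m+n b j))) init-one

  Invariant : ℕ → Set
  Invariant m = SlowUpTo seq m × (N < m → ArgsOK seq a b k m × (seq m ≡ RHS seq a b k m))

  initial-step : ∀ m → m < N → 1 ≤ m → Step (seq m) (seq (suc m))
  initial-step m m<N m≥1 = subst₂ Step (sym (seq-init m (<⇒≤ m<N))) (sym (seq-init (suc m) m<N))
                             (init-slow (suc m) (s≤s m≥1) m<N)

  -- At N + 1 hypothesis (II) applies, transported from init to seq.
  first-term : ArgsOK seq a b k (suc N) × (seq (suc N) ≡ RHS seq a b k (suc N))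
                 × Step (seq N) (seq (suc N))
  first-term = args , rec , subst₂ Step (sym (seq-init N ≤-refl)) (sym (trans rec same-rhs)) init-step
    where
    args : ArgsOK seq a b k (suc N)
    args = proj₁ (recursion-local a b k seq-init init-args)
    same-rhs : RHS seq a b k (suc N) ≡ RHS init a b k (suc N)
    same-rhs = proj₂ (recursion-local a b k seq-init init-args)
    rec : seq (suc N) ≡ RHS seq a b k (suc N)
    rec = seq-rec N ≤-refl args

  invariant : ∀ m → Invariant m
  invariant zero = (λ y _ ()) , (λ ())
  invariant (suc m) with invariant m | <-cmp m N
  ... | (slow , _) | tri< m<N _ _ =
    slow-extend slow (initial-step m m<N) , (λ N<sm → ⊥-elim (<⇒≱ N<sm m<N))
  ... | (slow , _) | tri≈ _ refl _ =
    let (args , rec , step) = first-term in slow-extend slow (λ _ → step) , (λ _ → args , rec)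
  ... | (slow , recursion) | tri> _ _ N<m =
    slow-extend slow (λ _ → step-next (proj₂ (recursion N<m)) rec) , (λ _ → args-next , rec)
    where
    open RecursionStep a b k b≥1 seq-one slow (proj₁ (recursion N<m))
    rec : seq (suc m) ≡ RHS seq a b k (suc m)
    rec = seq-rec m (<⇒≤ N<m) args-next

proposition1 : (a b k j : ℕ) → 1 ≤ b → 1 ≤ k → (init : ℕ → ℕ)
    → (∀ i → 1 ≤ i → i ≤ b + j → 1 ≤ init i)
    → (∀ i → 2 ≤ i → i ≤ b + j → Step (init (i ∸ 1)) (init i))
    → init 1 ≡ 1
    → ArgsOK init a b k (suc (b + j))
    → Step (init (b + j)) (RHS init a b k (suc (b + j)))
    → ∃[ A ] ((∀ i → 1 ≤ i → i ≤ b + j → A i ≡ init i)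
    × (∀ n → b + j < n → ArgsOK A a b k n × (A n ≡ RHS A a b k n))
    × (∀ n → 2 ≤ n → Step (A (n ∸ 1)) (A n))
    × (∀ M → ∃[ n ] ((1 ≤ n) × (M ≤ A n))))
proposition1 a b k j b≥1 k≥1 init _ init-slow init-one init-args init-step =
  seq , (λ i _ i≤N → seq-init i i≤N) , recursion , slow-growing
      , Growth.unbounded a b k k≥1 seq-one N slow recursion
  where
  open Main a b k j b≥1 init init-slow init-one init-args init-step
  slow : ∀ m → SlowUpTo seq m
  slow m = proj₁ (invariant m)
  recursion : ∀ n → N < n → ArgsOK seq a b k n × (seq n ≡ RHS seq a b k n)
  recursion n = proj₂ (invariant n)
  slow-growing : ∀ n → 2 ≤ n → Step (seq (n ∸ 1)) (seq n)
  slow-growing (suc (suc z)) (s≤s (s≤s _)) = slow (suc (suc z)) (suc z) (s≤s z≤n) ≤-refl
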